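{- Let $D$ be a digraph, let $T \subseteq V(D)$ with $|T| = s$, and let $r \ge \lfloor s/2 \rfloor$ be an integer. If $T$ is $(k,r)$-linked, then $D$ admits a haven of order $k+1$.
   Context: For $T \subseteq V(D)$ and a positive integer $r$, a $(T,r)$-balanced separator is a set $Z \subseteq V(D)$ such that every strong component of $D\setminus Z$ contains at most $r$ vertices of $T$; $T$ is $(k,r)$-linked if every $(T,r)$-balanced separator has size at least $k+1$. A haven of order $h$ in $D$ is a function $\beta$ assigning to every set $Z \subseteq V(D)$ with $|Z|\le h-1$ the vertex set of a strong component of $D\setminus Z$, such that $Z'\subseteq Z$ implies $\beta(Z)\subseteq\beta(Z')$. -}

module Defs where

open import Data.Nat using (ℕ; suc; _≤_; _<_)
open import Data.Bool using (Bool; true)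
open import Data.Fin using (Fin)
open import Data.Fin.Subset using (Subset; _∈_; _∉_; _⊆_; _∩_; ∣_∣)
open import Data.Product using (Σ; ∃; _×_)
open import Relation.Binary.PropositionalEquality using (_≡_)
open import Function.Bundles using (_⇔_)

record Digraph : Set where
  field
    n   : ℕ
    adj : Fin n → Fin n → Bool

open Digraph public

Vertex : Digraph → Set
Vertex D = Fin (n D)

VSet : Digraph → Set
VSet D = Subset (n D)

Arc : (D : Digraph) → Vertex D → Vertex D → Set
Arc D u v = adj D u v ≡ true

data Reach (D : Digraph) (Z : VSet D) : Vertex D → Vertex D → Set where
  here : ∀ {u} → u ∉ Z → Reach D Z u u
  step : ∀ {u w v} → u ∉ Z → Arc D u w → Reach D Z w v → Reach D Z u v

IsStrongComp : (D : Digraph) → VSet D → VSet D → Set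
IsStrongComp D Z C =
  (∃ λ u → u ∈ C) ×
  (∀ u → u ∈ C → u ∉ Z × (∀ v → (v ∈ C) ⇔ (Reach D Z u v × Reach D Z v u)))

BalancedSep : (D : Digraph) → VSet D → ℕ → VSet D → Set
BalancedSep D T r Z = ∀ C → IsStrongComp D Z C → ∣ T ∩ C ∣ ≤ r

Linked : (D : Digraph) → ℕ → ℕ → VSet D → Set
Linked D k r T = ∀ Z → BalancedSep D T r Z → suc k ≤ ∣ Z ∣

-- A haven of order h: β assigns to every Z with |Z| ≤ h - 1 (i.e. |Z| < h)
-- a strong component of D \ Z, monotone (antitone) w.r.t. inclusion.
-- β is given as a total function on subsets; its values on larger sets are irrelevant.
record Haven (D : Digraph) (h : ℕ) : Set where
  field
    β        : VSet D → VSet D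
    β-comp   : ∀ Z → ∣ Z ∣ < h → IsStrongComp D Z (β Z)
    β-mono   : ∀ Z' Z → ∣ Z ∣ < h → Z' ⊆ Z → β Z ⊆ β Z'

module Submission where

-- Call a vertex v *heavy* for Z if v ∉ Z and the strong component of D \ Z
-- through v contains more than r vertices of T.  The haven sends Z to the set of heavy
-- vertices.  Three facts make this work:
--   * existence: if |Z| ≤ k then some vertex is heavy, for otherwise every
--     strong component of D \ Z meets T in at most r vertices and Z would be
--     a (T,r)-balanced separator of size ≤ k, contradicting linkedness;
--   * uniqueness: two disjoint components cannot both contain more than r
--     vertices of T, since |T| ≤ 2r+1; so all heavy vertices are mutually
--     reachable, i.e. they form exactly one strong component;
--   * antitonicity: shrinking Z to Z' ⊆ Z only enlarges components, so a
--     heavy vertex for Z is heavy for Z'.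

open import Defs
open import Data.Nat using (ℕ; zero; suc; _+_; _*_; _%_; _≤_; _<_; _/_; _<?_; s≤s)
open import Data.Nat.Properties
  using (≤-trans; <-≤-trans; <⇒≱; <-irrefl; ≤-antisym; ≮⇒≥; m≤n+m; +-suc; +-identityʳ;
         +-mono-≤; *-monoˡ-≤; *-comm; ≤-pred; ≤-reflexive; module ≤-Reasoning)
open import Data.Nat.DivMod using (m≡m%n+[m/n]*n; m%n<n)
open import Data.Bool using (true)
open import Data.Bool.Properties using (T-≡)
import Data.Bool as Bool
open import Data.Fin using (Fin; _≟_) renaming (zero to fzero; suc to fsuc)
open import Data.Fin.Properties using (any?)
open import Data.Fin.Subset using (Subset; _∈_; _∉_; _⊆_; _∩_; _∪_; ⁅_⁆; ⊤; ∣_∣; inside; outside)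
open import Data.Fin.Subset.Properties
  using (p⊆q⇒∣p∣≤∣q∣; ∣p∣≤n; ∣p∣≡n⇒p≡⊤; ∈⊤; _∈?_; x∈p∩q⁺; x∈p∩q⁻; x∈p∪q⁻;
         x∈⁅x⁆; x∈⁅y⁆⇒x≡y; p⊆p∪q; q⊆p∪q; ∪-identityˡ)
open import Data.Vec using ([]; _∷_; tabulate)
open import Data.Vec.Properties using (lookup∘tabulate; []=⇒lookup; lookup⇒[]=)
open import Data.Product using (∃; _×_; _,_; proj₁; proj₂)
open import Data.Sum using (_⊎_; inj₁; inj₂; [_,_])
open import Relation.Nullary using (Dec; yes; no; ¬_; contradiction)
open import Relation.Nullary.Decidable using (⌊_⌋; ¬?; _×-dec_; toWitness; fromWitness)
open import Relation.Unary using (Pred; Decidable)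
open import Relation.Binary.PropositionalEquality using (_≡_; _≢_; refl; sym; trans; cong; subst)
open import Function using (_∘_)
open import Function.Bundles using (_⇔_; mk⇔; Equivalence)
import Data.Vec.Base as Vec

select : ∀ {n p} {P : Pred (Fin n) p} → Decidable P → Subset n
select P? = tabulate (λ x → ⌊ P? x ⌋)

∈-select : ∀ {n p} {P : Pred (Fin n) p} (P? : Decidable P) {x : Fin n} → x ∈ select P? ⇔ P x
∈-select P? {x} = mk⇔
  (λ x∈ → toWitness (Equivalence.from T-≡ (trans (sym (lookup∘tabulate _ x)) ([]=⇒lookup x∈))))
  (λ Px → lookup⇒[]= x _ (trans (lookup∘tabulate _ x) (Equivalence.to T-≡ (fromWitness Px))))

-- Adding a new element to a subset increases its size by one; this is the
-- termination measure for deciding reachability.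
∣⁅x⁆∪p∣≡1+∣p∣ : ∀ {n} (x : Fin n) (p : Subset n) → x ∉ p → ∣ ⁅ x ⁆ ∪ p ∣ ≡ suc ∣ p ∣
∣⁅x⁆∪p∣≡1+∣p∣ fzero    (inside ∷ p)  x∉p = contradiction Vec.here x∉p
∣⁅x⁆∪p∣≡1+∣p∣ fzero    (outside ∷ p) x∉p = cong suc (cong ∣_∣ (∪-identityˡ p))
∣⁅x⁆∪p∣≡1+∣p∣ (fsuc x) (inside ∷ p)  x∉p = cong suc (∣⁅x⁆∪p∣≡1+∣p∣ x p (x∉p ∘ Vec.there))
∣⁅x⁆∪p∣≡1+∣p∣ (fsuc x) (outside ∷ p) x∉p = ∣⁅x⁆∪p∣≡1+∣p∣ x p (x∉p ∘ Vec.there)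

∉⁅y⁆∪p : ∀ {n} {x y : Fin n} {p : Subset n} → x ≢ y → x ∉ p → x ∉ ⁅ y ⁆ ∪ p
∉⁅y⁆∪p {y = y} {p} x≢y x∉p x∈ = [ x≢y ∘ x∈⁅y⁆⇒x≡y y , x∉p ] (x∈p∪q⁻ ⁅ y ⁆ p x∈)

Disjoint : ∀ {n} → Subset n → Subset n → Set
Disjoint p q = ∀ {x} → x ∈ p → x ∉ q

∷-disjoint : ∀ {n s t} {p q : Subset n} → Disjoint (s ∷ p) (t ∷ q) → Disjoint p q
∷-disjoint pq x∈p x∈q = pq (Vec.there x∈p) (Vec.there x∈q)

∣p∪q∣-disjoint : ∀ {n} (p q : Subset n) → Disjoint p q → ∣ p ∣ + ∣ q ∣ ≡ ∣ p ∪ q ∣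
∣p∪q∣-disjoint []            []            _  = refl
∣p∪q∣-disjoint (inside ∷ p)  (inside ∷ q)  pq = contradiction Vec.here (pq Vec.here)
∣p∪q∣-disjoint (inside ∷ p)  (outside ∷ q) pq = cong suc (∣p∪q∣-disjoint p q (∷-disjoint pq))
∣p∪q∣-disjoint (outside ∷ p) (inside ∷ q)  pq =
  trans (+-suc ∣ p ∣ ∣ q ∣) (cong suc (∣p∪q∣-disjoint p q (∷-disjoint pq)))
∣p∪q∣-disjoint (outside ∷ p) (outside ∷ q) pq = ∣p∪q∣-disjoint p q (∷-disjoint pq)

disjoint-traces : ∀ {n} (t p q : Subset n) → Disjoint p q → ∣ t ∩ p ∣ + ∣ t ∩ q ∣ ≤ ∣ t ∣
disjoint-traces t p q pq = begin
  ∣ t ∩ p ∣ + ∣ t ∩ q ∣  ≡⟨ ∣p∪q∣-disjoint (t ∩ p) (t ∩ q) traces-disjoint ⟩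
  ∣ t ∩ p ∪ t ∩ q ∣      ≤⟨ p⊆q⇒∣p∣≤∣q∣ traces⊆t ⟩
  ∣ t ∣                  ∎
  where
  open ≤-Reasoning
  traces-disjoint : Disjoint (t ∩ p) (t ∩ q)
  traces-disjoint x∈tp x∈tq = pq (proj₂ (x∈p∩q⁻ t p x∈tp)) (proj₂ (x∈p∩q⁻ t q x∈tq))
  traces⊆t : t ∩ p ∪ t ∩ q ⊆ t
  traces⊆t {x} x∈ = [ proj₁ ∘ x∈p∩q⁻ t p , proj₁ ∘ x∈p∩q⁻ t q ] (x∈p∪q⁻ (t ∩ p) (t ∩ q) x∈)

∩-monoʳ : ∀ {n} (t : Subset n) {p q : Subset n} → p ⊆ q → t ∩ p ⊆ t ∩ q
∩-monoʳ t {p} p⊆q x∈tp = let (x∈t , x∈p) = x∈p∩q⁻ t p x∈tp in x∈p∩q⁺ (x∈t , p⊆q x∈p)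

-- If ⌊m/2⌋ ≤ r then m ≤ 2r+1, so m cannot hold two disjoint parts of size > r.
no-two-majorities : ∀ m r → m / 2 ≤ r → ¬ (suc r + suc r ≤ m)
no-two-majorities m r m/2≤r two≤m = <-irrefl refl (≤-trans m<2r+2 two≤m)
  where
  open ≤-Reasoning
  m<2r+2 : m < suc r + suc r
  m<2r+2 = begin-strict
    m                   ≡⟨ m≡m%n+[m/n]*n m 2 ⟩
    m % 2 + (m / 2) * 2 ≤⟨ +-mono-≤ (≤-pred (m%n<n m 2)) (*-monoˡ-≤ 2 m/2≤r) ⟩
    1 + r * 2           ≡⟨ cong suc (trans (*-comm r 2) (cong (r +_) (+-identityʳ r))) ⟩
    suc (r + r)         <⟨ s≤s (≤-reflexive (sym (+-suc r r))) ⟩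
    suc r + suc r       ∎

module Reachability (D : Digraph) where

  start∉ : ∀ {Z u v} → Reach D Z u v → u ∉ Z
  start∉ (here u∉Z)     = u∉Z
  start∉ (step u∉Z _ _) = u∉Z

  concat : ∀ {Z u v w} → Reach D Z u v → Reach D Z v w → Reach D Z u w
  concat (here _)         q = q
  concat (step u∉Z a p) q = step u∉Z a (concat p q)

  widen : ∀ {Z' Z u v} → Z' ⊆ Z → Reach D Z u v → Reach D Z' u v
  widen Z'⊆Z (here u∉Z)     = here (u∉Z ∘ Z'⊆Z)
  widen Z'⊆Z (step u∉Z a p) = step (u∉Z ∘ Z'⊆Z) a (widen Z'⊆Z p)

  -- Cutting a walk after its last visit to u (when it does not end at u):
  -- either the walk avoids u altogether, or some out-neighbour of u reaches
  -- the end while avoiding u.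
  after-last-visit : ∀ {Z} (u : Vertex D) {x v} → v ≢ u → Reach D Z x v →
    Reach D (⁅ u ⁆ ∪ Z) x v ⊎ ∃ λ w → Arc D u w × Reach D (⁅ u ⁆ ∪ Z) w v
  after-last-visit {Z} u v≢u (here v∉Z) = inj₁ (here (∉⁅y⁆∪p v≢u v∉Z))
  after-last-visit {Z} u v≢u (step {x} x∉Z a p) with after-last-visit u v≢u p
  ... | inj₂ later = inj₂ later
  ... | inj₁ p' with x ≟ u
  ...   | yes refl = inj₂ (_ , a , p')
  ...   | no x≢u   = inj₁ (step (∉⁅y⁆∪p x≢u x∉Z) a p')

  -- Reachability in D \ Z is decidable, by recursion on the number of
  -- vertices outside Z: a walk from u ≠ v leaves u for good through an arc.
  reach?-bounded : ∀ m Z → n D ≤ ∣ Z ∣ + m → ∀ u v → Dec (Reach D Z u v)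
  reach?-bounded zero Z n≤∣Z∣ u v = no (λ p → start∉ p (subst (u ∈_) (sym Z-full) ∈⊤))
    where
    Z-full : Z ≡ ⊤
    Z-full = ∣p∣≡n⇒p≡⊤ (≤-antisym (∣p∣≤n Z) (subst (n D ≤_) (+-identityʳ ∣ Z ∣) n≤∣Z∣))
  reach?-bounded (suc m) Z bound u v with u ∈? Z | u ≟ v
  ... | yes u∈Z | _        = no (λ p → start∉ p u∈Z)
  ... | no u∉Z  | yes refl = yes (here u∉Z)
  ... | no u∉Z  | no u≢v   with any? (λ w → (adj D u w Bool.≟ true) ×-dec reach?-bounded m (⁅ u ⁆ ∪ Z) bound′ w v)
    where
    bound′ : n D ≤ ∣ ⁅ u ⁆ ∪ Z ∣ + m
    bound′ = subst (λ s → n D ≤ s + m) (sym (∣⁅x⁆∪p∣≡1+∣p∣ u Z u∉Z)) (subst (n D ≤_) (+-suc ∣ Z ∣ m) bound)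
  ... | yes (w , a , p) = yes (step u∉Z a (widen (q⊆p∪q ⁅ u ⁆ Z) p))
  ... | no ¬exit        = no λ p →
        [ (λ p' → start∉ p' (p⊆p∪q Z (x∈⁅x⁆ u))) , ¬exit ] (after-last-visit u (u≢v ∘ sym) p)

  reach? : ∀ Z u v → Dec (Reach D Z u v)
  reach? Z = reach?-bounded (n D) Z (m≤n+m (n D) ∣ Z ∣)

  Mutual : VSet D → Vertex D → Vertex D → Set
  Mutual Z u v = Reach D Z u v × Reach D Z v u

  mutual? : ∀ Z u → Decidable (Mutual Z u)
  mutual? Z u v = reach? Z u v ×-dec reach? Z v u

  mutual-sym : ∀ {Z u v} → Mutual Z u v → Mutual Z v u
  mutual-sym (p , q) = q , p

  mutual-trans : ∀ {Z u v w} → Mutual Z u v → Mutual Z v w → Mutual Z u w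
  mutual-trans (p , q) (p' , q') = concat p p' , concat q' q

  -- The strong component of D \ Z through u (empty when u ∈ Z).
  component : VSet D → Vertex D → VSet D
  component Z u = select (mutual? Z u)

  ∈-component : ∀ {Z u v} → v ∈ component Z u ⇔ Mutual Z u v
  ∈-component {Z} {u} = ∈-select (mutual? Z u)

  component-⊆ : ∀ {Z u v} → Mutual Z u v → component Z v ⊆ component Z u
  component-⊆ uv x∈ = Equivalence.from ∈-component (mutual-trans uv (Equivalence.to ∈-component x∈))

  component-antitone : ∀ {Z' Z u} → Z' ⊆ Z → component Z u ⊆ component Z' u
  component-antitone Z'⊆Z x∈ =
    let (p , q) = Equivalence.to ∈-component x∈ in
    Equivalence.from ∈-component (widen Z'⊆Z p , widen Z'⊆Z q)

  components-disjoint : ∀ {Z u v} → ¬ Mutual Z u v → Disjoint (component Z u) (component Z v)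
  components-disjoint ¬uv x∈u x∈v =
    ¬uv (mutual-trans (Equivalence.to ∈-component x∈u) (mutual-sym (Equivalence.to ∈-component x∈v)))

  strongComp⊆component : ∀ {Z C u} → IsStrongComp D Z C → u ∈ C → C ⊆ component Z u
  strongComp⊆component (_ , C-classes) u∈C x∈C =
    Equivalence.from ∈-component (Equivalence.to (proj₂ (C-classes _ u∈C) _) x∈C)

module Heavy (D : Digraph) (T : VSet D) (r : ℕ) where
  open Reachability D

  Heavy : VSet D → Vertex D → Set
  Heavy Z u = u ∉ Z × r < ∣ T ∩ component Z u ∣

  heavy? : ∀ Z → Decidable (Heavy Z)
  heavy? Z u = ¬? (u ∈? Z) ×-dec (r <? ∣ T ∩ component Z u ∣)

  heavy-closed : ∀ {Z u v} → Mutual Z u v → Heavy Z u → Heavy Z v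
  heavy-closed uv (_ , heavy-u) =
    start∉ (proj₂ uv) , <-≤-trans heavy-u (p⊆q⇒∣p∣≤∣q∣ (∩-monoʳ T (component-⊆ (mutual-sym uv))))

  heavy-antitone : ∀ {Z' Z u} → Z' ⊆ Z → Heavy Z u → Heavy Z' u
  heavy-antitone Z'⊆Z (u∉Z , heavy-u) =
    u∉Z ∘ Z'⊆Z , <-≤-trans heavy-u (p⊆q⇒∣p∣≤∣q∣ (∩-monoʳ T (component-antitone Z'⊆Z)))

  heavy-unique : ∣ T ∣ / 2 ≤ r → ∀ {Z u v} → Heavy Z u → Heavy Z v → Mutual Z u v
  heavy-unique T/2≤r {Z} {u} {v} (_ , heavy-u) (_ , heavy-v) with mutual? Z u v
  ... | yes uv = uv
  ... | no ¬uv = contradiction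
        (≤-trans (+-mono-≤ heavy-u heavy-v) (disjoint-traces T _ _ (components-disjoint ¬uv)))
        (no-two-majorities ∣ T ∣ r T/2≤r)

  -- If T is (k,r)-linked, every Z with |Z| ≤ k has a heavy vertex: otherwise
  -- Z would be a small (T,r)-balanced separator.
  heavy-exists : ∀ {k} → Linked D k r T → ∀ Z → ∣ Z ∣ < suc k → ∃ (Heavy Z)
  heavy-exists linked Z ∣Z∣<1+k with any? (heavy? Z)
  ... | yes heavy = heavy
  ... | no ¬heavy = contradiction (linked Z balanced) (<⇒≱ ∣Z∣<1+k)
    where
    balanced : BalancedSep D T r Z
    balanced C C-comp@((u , u∈C) , C-classes) = ≤-trans
      (p⊆q⇒∣p∣≤∣q∣ (∩-monoʳ T (strongComp⊆component C-comp u∈C)))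
      (≮⇒≥ (λ heavy-u → ¬heavy (u , proj₁ (C-classes u u∈C) , heavy-u)))

  heavyHaven : ∀ {k} → ∣ T ∣ / 2 ≤ r → Linked D k r T → Haven D (suc k)
  heavyHaven {k} T/2≤r linked = record
    { β      = β
    ; β-comp = β-comp
    ; β-mono = λ Z' Z _ Z'⊆Z x∈ → ∈β.from (heavy-antitone Z'⊆Z (∈β.to x∈))
    }
    where
    β : VSet D → VSet D
    β Z = select (heavy? Z)

    module ∈β {Z} {x} = Equivalence (∈-select (heavy? Z) {x})

    β-comp : ∀ Z → ∣ Z ∣ < suc k → IsStrongComp D Z (β Z)
    β-comp Z ∣Z∣<1+k =
      let (u , heavy-u) = heavy-exists linked Z ∣Z∣<1+k in
      (u , ∈β.from heavy-u) , λ w w∈β →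
        let heavy-w = ∈β.to w∈β in
        proj₁ heavy-w , λ v → mk⇔ (heavy-unique T/2≤r heavy-w ∘ ∈β.to)
                                  (λ wv → ∈β.from (heavy-closed wv heavy-w))

mainTheorem2 : (D : Digraph) (T : VSet D) (k r : ℕ) →
    ∣ T ∣ / 2 ≤ r → Linked D k r T → Haven D (suc k)
mainTheorem2 D T k r T/2≤r linked = Heavy.heavyHaven D T r T/2≤r linked
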